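{- Let $P\subset\mathbb{Z}^3$ be the $3$--polycube consisting of the twelve unit cubes with centers $(x,y,0)$ for $(x,y)\in\{(-2,0),(-1,-1),(-1,0),(-1,1),(0,-2),(0,-1),(0,1),(0,2),(1,-1),(1,0),(1,1),(2,0)\}$. Then the maximal number of pairwise non-attacking rooks that can be placed on $P$ (such a set dominates $P$) is $6$, and there are exactly two such sets of $6$ rooks: rooks on the four cubes $(\pm2,0,0),(0,\pm2,0)$ together with either both of $(-1,-1,0),(1,1,0)$ or both of $(1,-1,0),(-1,1,0)$.
   Context: Identify unit cubes of the cubic tessellation of $\mathbb{R}^3$ with their centers in $\mathbb{Z}^3$. A rook on a cube $p$ of a polycube $P$ guards $p$ and, for each $u=\pm e_i$ ($i=1,2,3$) and each $k\ge 1$, guards $p+ku$ provided $p+ju\in P$ for all $1\le j\le k$. Two rooks attack each other if one guards the cube of the other; a set of rooks dominates $P$ if every cube of $P$ is guarded. -}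

module Defs where

open import Data.Nat using (ℕ; _≤_)
open import Data.Integer using (ℤ; +_; -_; _+_; _*_)
open import Data.Product using (_×_; _,_; Σ)
open import Data.Sum using (_⊎_)
open import Data.List using (List; []; _∷_; length)
open import Data.List.Membership.Propositional using (_∈_)
open import Data.List.Relation.Unary.All using (All)
open import Data.List.Relation.Unary.AllPairs using (AllPairs)
open import Data.List.Relation.Unary.Unique.Propositional using (Unique)
open import Relation.Binary.PropositionalEquality using (_≡_)
open import Relation.Nullary using (¬_)
open import Function.Bundles using (_⇔_)

-- A unit cube of the cubic tessellation, identified with its center in ℤ³.
Cube : Set
Cube = ℤ × ℤ × ℤ

Polycube : Set₁
Polycube = Cube → Set

data Dir : Set where
  +e₁ -e₁ +e₂ -e₂ +e₃ -e₃ : Dir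

shift : Dir → ℕ → Cube → Cube
shift +e₁ k (x , y , z) = (x + + k , y , z)
shift -e₁ k (x , y , z) = (x + - (+ k) , y , z)
shift +e₂ k (x , y , z) = (x , y + + k , z)
shift -e₂ k (x , y , z) = (x , y + - (+ k) , z)
shift +e₃ k (x , y , z) = (x , y , z + + k)
shift -e₃ k (x , y , z) = (x , y , z + - (+ k))

Guards : Polycube → Cube → Cube → Set
Guards P p q =
  (q ≡ p) ⊎
  Σ Dir (λ u → Σ ℕ (λ k → (1 ≤ k) × (q ≡ shift u k p) ×
     (∀ j → 1 ≤ j → j ≤ k → P (shift u j p))))

Attack : Polycube → Cube → Cube → Set
Attack P p q = Guards P p q ⊎ Guards P q p

RookSet : Polycube → List Cube → Set
RookSet P S = Unique S × All P S

NonAttacking : Polycube → List Cube → Set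
NonAttacking P S = RookSet P S × AllPairs (λ p q → ¬ Attack P p q) S

Dominates : Polycube → List Cube → Set
Dominates P S = ∀ q → P q → Σ Cube (λ p → (p ∈ S) × Guards P p q)

SameSet : List Cube → List Cube → Set
SameSet S T = ∀ c → (c ∈ S) ⇔ (c ∈ T)

pt : ℤ → ℤ → Cube
pt x y = (x , y , + 0)

cellsP : List Cube
cellsP =
  pt (- + 2) (+ 0) ∷ pt (- + 1) (- + 1) ∷ pt (- + 1) (+ 0) ∷ pt (- + 1) (+ 1) ∷
  pt (+ 0) (- + 2) ∷ pt (+ 0) (- + 1) ∷ pt (+ 0) (+ 1) ∷ pt (+ 0) (+ 2) ∷
  pt (+ 1) (- + 1) ∷ pt (+ 1) (+ 0) ∷ pt (+ 1) (+ 1) ∷ pt (+ 2) (+ 0) ∷ []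

P₃₁ : Polycube
P₃₁ c = c ∈ cellsP

rooksA : List Cube
rooksA = pt (+ 2) (+ 0) ∷ pt (- + 2) (+ 0) ∷ pt (+ 0) (+ 2) ∷ pt (+ 0) (- + 2) ∷
         pt (- + 1) (- + 1) ∷ pt (+ 1) (+ 1) ∷ []

rooksB : List Cube
rooksB = pt (+ 2) (+ 0) ∷ pt (- + 2) (+ 0) ∷ pt (+ 0) (+ 2) ∷ pt (+ 0) (- + 2) ∷
         pt (+ 1) (- + 1) ∷ pt (- + 1) (+ 1) ∷ []

-- No cube of P starts three consecutive cubes of P in a line, so every rook's
-- reach on P is at most two steps and "attacks" is a decidable relation on
-- the twelve cubes. A set of non-attacking rooks is, up to order, an
-- independent sublist of the cube list of P for this relation; enumerating
-- all such sublists shows that they have at most six elements and that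
-- exactly two have six, namely the two listed sets.
module Submission where

open import Defs
open import Data.Nat as ℕ using (ℕ; zero; suc; _≤_; _<_; _≤?_; z≤n; s≤s)
open import Data.Nat.Properties
  using (≤-trans; ≤-refl; ≤-pred; m≤n⇒m≤1+n; m≤n⇒m<n∨m≡n; ≰⇒>; anyUpTo?)
open import Data.Integer as ℤ using (ℤ; +_; -_; _+_)
open import Data.Integer.Properties using (+-assoc; neg-distrib-+)
open import Data.Product using (_×_; _,_; Σ; proj₂)
open import Data.Product.Properties using (≡-dec)
open import Data.Sum using (_⊎_; inj₁; inj₂; [_,_]′; swap)
open import Data.List using (List; []; _∷_; _++_; length; map; filter)
open import Data.List.Relation.Unary.All as All using (All; all?)
open import Data.List.Relation.Unary.Any using (Any; any?; here; there)
open import Data.List.Relation.Unary.AllPairs using (AllPairs; []; _∷_; allPairs?)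
open import Data.List.Relation.Unary.Unique.Propositional using (Unique)
import Data.List.Relation.Unary.Unique.Propositional.Properties as Unique
import Data.List.Relation.Unary.Unique.DecPropositional as UniqueDec
open import Data.List.Membership.Propositional using (_∈_; find; lose)
open import Data.List.Membership.Propositional.Properties
  using (∈-++⁺ˡ; ∈-++⁺ʳ; ∈-map⁺; ∈-filter⁺; ∈-filter⁻)
open import Data.List.Membership.Propositional.Properties.WithK using (unique∧set⇒bag)
import Data.List.Membership.DecPropositional as MembershipDec
open import Data.List.Relation.Binary.Subset.Propositional using (_⊆_)
import Data.List.Relation.Binary.Subset.DecPropositional as SubsetDec
open import Data.List.Relation.Binary.Sublist.Propositional
  using ([]; _∷_; _∷ʳ_) renaming (_⊆_ to _⊑_)
open import Data.List.Relation.Binary.Sublist.Propositional.Properties using (filter-⊆)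
open import Data.List.Relation.Binary.Permutation.Propositional using (_↭_; ↭-sym; ↭⇒↭ₛ)
open import Data.List.Relation.Binary.Permutation.Propositional.Properties
  using (↭-length; ∈-resp-↭)
import Data.List.Relation.Binary.Permutation.Setoid.Properties as Permutationₛ
open import Data.List.Relation.Binary.BagAndSetEquality using (∼bag⇒↭)
open import Function.Bundles using (mk⇔; Equivalence)
open import Function.Properties.Equivalence using () renaming (trans to ⇔-trans)
open import Relation.Binary.Definitions using (DecidableEquality; Decidable; Symmetric)
open import Relation.Binary.PropositionalEquality
  using (_≡_; refl; sym; trans; cong; subst; setoid; resp₂)
open import Relation.Nullary using (¬_; Dec; yes; ¬?; contradiction)
open import Relation.Nullary.Decidable using (map′; _×-dec_; _⊎-dec_; from-yes)

_≟ᶜ_ : DecidableEquality Cube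
_≟ᶜ_ = ≡-dec ℤ._≟_ (≡-dec ℤ._≟_ ℤ._≟_)

open MembershipDec _≟ᶜ_ using (_∈?_)

Run : Polycube → Dir → ℕ → Cube → Set
Run P u k p = ∀ j → 1 ≤ j → j ≤ k → P (shift u j p)

Run-mono : ∀ {P u k l p} → k ≤ l → Run P u l p → Run P u k p
Run-mono k≤l r j 1≤j j≤k = r j 1≤j (≤-trans j≤k k≤l)

x+[1+j]≡x+1+j : ∀ x j → x + + suc j ≡ (x + + 1) + + j
x+[1+j]≡x+1+j x j = sym (+-assoc x (+ 1) (+ j))

x-[1+j]≡x-1-j : ∀ x j → x + - + suc j ≡ (x + - + 1) + - + j
x-[1+j]≡x-1-j x j =
  trans (cong (_+_ x) (neg-distrib-+ (+ 1) (+ j))) (sym (+-assoc x (- + 1) (- + j)))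

shift-suc : ∀ u j p → shift u (suc j) p ≡ shift u j (shift u 1 p)
shift-suc +e₁ j (x , y , z) = cong (λ x′ → x′ , y , z) (x+[1+j]≡x+1+j x j)
shift-suc -e₁ j (x , y , z) = cong (λ x′ → x′ , y , z) (x-[1+j]≡x-1-j x j)
shift-suc +e₂ j (x , y , z) = cong (λ y′ → x , y′ , z) (x+[1+j]≡x+1+j y j)
shift-suc -e₂ j (x , y , z) = cong (λ y′ → x , y′ , z) (x-[1+j]≡x-1-j y j)
shift-suc +e₃ j (x , y , z) = cong (λ z′ → x , y , z′) (x+[1+j]≡x+1+j z j)
shift-suc -e₃ j (x , y , z) = cong (λ z′ → x , y , z′) (x-[1+j]≡x-1-j z j)

Run-tail : ∀ {P u k p} → Run P u (suc k) p → Run P u k (shift u 1 p)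
Run-tail {P} {u} {p = p} r j _ j≤k =
  subst P (shift-suc u j p) (r (suc j) (s≤s z≤n) (s≤s j≤k))

no-longer-Run : ∀ {P m} → (∀ c → P c → ∀ u → ¬ Run P u m c) →
                ∀ p u → ¬ Run P u (suc m) p
no-longer-Run {P} short p u r =
  short (shift u 1 p) (r 1 ≤-refl (s≤s z≤n)) u (Run-tail {P} {u} {p = p} r)

allDirs : List Dir
allDirs = +e₁ ∷ -e₁ ∷ +e₂ ∷ -e₂ ∷ +e₃ ∷ -e₃ ∷ []

∈-allDirs : ∀ u → u ∈ allDirs
∈-allDirs +e₁ = here refl
∈-allDirs -e₁ = there (here refl)
∈-allDirs +e₂ = there (there (here refl))
∈-allDirs -e₂ = there (there (there (here refl)))
∈-allDirs +e₃ = there (there (there (there (here refl))))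
∈-allDirs -e₃ = there (there (there (there (there (here refl)))))

∃-Dir? : ∀ {Q : Dir → Set} → (∀ u → Dec (Q u)) → Dec (Σ Dir Q)
∃-Dir? Q? = map′ (λ q → let (u , _ , qu) = find q in u , qu)
                 (λ (u , qu) → lose (∈-allDirs u) qu)
                 (any? Q? allDirs)

∀-Dir? : ∀ {Q : Dir → Set} → (∀ u → Dec (Q u)) → Dec (∀ u → Q u)
∀-Dir? Q? = map′ (λ q u → All.lookup q (∈-allDirs u))
                 (λ q → All.tabulate (λ {u} _ → q u))
                 (all? Q? allDirs)

module _ {P : Polycube} (P? : ∀ c → Dec (P c)) where

  run? : ∀ u k p → Dec (Run P u k p)
  run? u zero    p = yes λ j 1≤j j≤0 → contradiction (≤-trans 1≤j j≤0) λ ()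
  run? u (suc k) p = map′ extend restrict (run? u k p ×-dec P? (shift u (suc k) p))
    where
    extend : Run P u k p × P (shift u (suc k) p) → Run P u (suc k) p
    extend (r , last) j 1≤j j≤1+k with m≤n⇒m<n∨m≡n j≤1+k
    ... | inj₁ j<1+k = r j 1≤j (≤-pred j<1+k)
    ... | inj₂ refl  = last

    restrict : Run P u (suc k) p → Run P u k p × P (shift u (suc k) p)
    restrict r = Run-mono {P} {u} {p = p} (m≤n⇒m≤1+n ≤-refl) r , r (suc k) (s≤s z≤n) ≤-refl

  module _ {m : ℕ} (short : ∀ p u → ¬ Run P u m p) where

    guards? : ∀ p q → Dec (Guards P p q)
    guards? p q = (q ≟ᶜ p) ⊎-dec ∃-Dir? along?
      where
      Along : Dir → ℕ → Set
      Along u k = 1 ≤ k × q ≡ shift u k p × Run P u k p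

      below-m : ∀ {u k} → Along u k → k < m
      below-m {u} (_ , _ , r) = ≰⇒> λ m≤k → short p u (Run-mono {P} {u} {p = p} m≤k r)

      along? : ∀ u → Dec (Σ ℕ (Along u))
      along? u = map′ (λ (k , _ , a) → k , a) (λ (k , a) → k , below-m a , a)
                      (anyUpTo? (λ k → (1 ≤? k) ×-dec ((q ≟ᶜ shift u k p) ×-dec run? u k p)) m)

    attack? : ∀ p q → Dec (Attack P p q)
    attack? p q = guards? p q ⊎-dec guards? q p

    nonAttacking? : ∀ S → Dec (NonAttacking P S)
    nonAttacking? S =
      (UniqueDec.unique? _≟ᶜ_ S ×-dec all? P? S) ×-dec allPairs? (λ p q → ¬? (attack? p q)) S

¬Attack-sym : ∀ {P} → Symmetric (λ p q → ¬ Attack P p q)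
¬Attack-sym ¬pq qp = ¬pq (swap qp)

guarded⇒Dominates : ∀ L R → All (λ q → Any (λ p → Guards (_∈ L) p q) R) L → Dominates (_∈ L) R
guarded⇒Dominates L R guarded q q∈L = find (All.lookup guarded q∈L)

Dominates-resp-SameSet : ∀ {P S T} → SameSet S T → Dominates P T → Dominates P S
Dominates-resp-SameSet S≈T dom q q∈P =
  let (p , p∈T , g) = dom q q∈P in p , Equivalence.from (S≈T p) p∈T , g

↭⇒SameSet : ∀ {S T} → S ↭ T → SameSet S T
↭⇒SameSet S↭T c = mk⇔ (∈-resp-↭ S↭T) (∈-resp-↭ (↭-sym S↭T))

⊆∧⊇⇒SameSet : ∀ {S T : List Cube} → S ⊆ T → T ⊆ S → SameSet S T
⊆∧⊇⇒SameSet S⊆T T⊆S c = mk⇔ S⊆T T⊆S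

SameSet-trans : ∀ {S T U} → SameSet S T → SameSet T U → SameSet S U
SameSet-trans S≈T T≈U c = ⇔-trans (S≈T c) (T≈U c)

module _ {A : Set} {R : A → A → Set} where

  AllPairs-resp-↭ : Symmetric R → ∀ {S T} → S ↭ T → AllPairs R S → AllPairs R T
  AllPairs-resp-↭ R-sym S↭T = Permutationₛ.AllPairs-resp-↭ (setoid A) R-sym (resp₂ R) (↭⇒↭ₛ S↭T)

  module _ (R? : Decidable R) where

    independentSublists : List A → List (List A)
    independentSublists []       = [] ∷ []
    independentSublists (x ∷ xs) = extendBy x (independentSublists xs)
      where
      -- Taking the recursive result as an argument lets the evaluator share it;
      -- writing the recursive call twice would recompute it, doubling the work per element.
      extendBy : A → List (List A) → List (List A)
      extendBy y I = map (y ∷_) (filter (all? (λ z → ¬? (R? y z))) I) ++ I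

    ∈-independentSublists : ∀ {ys xs} → ys ⊑ xs → AllPairs (λ x y → ¬ R x y) ys →
                            ys ∈ independentSublists xs
    ∈-independentSublists []             []             = here refl
    ∈-independentSublists (x ∷ʳ ys⊑xs)   ind            =
      ∈-++⁺ʳ _ (∈-independentSublists ys⊑xs ind)
    ∈-independentSublists {x ∷ _} (refl ∷ ys⊑xs) (x-free ∷ ind) =
      ∈-++⁺ˡ (∈-map⁺ (x ∷_) (∈-filter⁺ (all? (λ y → ¬? (R? x y)))
                                 (∈-independentSublists ys⊑xs ind) x-free))

module _ {A : Set} (_≟_ : DecidableEquality A) where

  open MembershipDec _≟_ using () renaming (_∈?_ to _∈?ₐ_)

  ↭-filter-∈ : ∀ {S V} → Unique S → Unique V → All (_∈ V) S → S ↭ filter (_∈?ₐ S) V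
  ↭-filter-∈ {S} {V} S! V! S⊆V =
    ∼bag⇒↭ (unique∧set⇒bag S! (Unique.filter⁺ (_∈?ₐ S) V!)
             (mk⇔ (λ x∈S → ∈-filter⁺ (_∈?ₐ S) (All.lookup S⊆V x∈S) x∈S)
                  (λ x∈T → proj₂ (∈-filter⁻ (_∈?ₐ S) {xs = V} x∈T))))

P₃₁? : ∀ c → Dec (P₃₁ c)
P₃₁? c = c ∈? cellsP

cellsP-unique : Unique cellsP
cellsP-unique = from-yes (UniqueDec.unique? _≟ᶜ_ cellsP)

no-Run₃-from-cells : ∀ c → P₃₁ c → ∀ u → ¬ Run P₃₁ u 3 c
no-Run₃-from-cells c =
  All.lookup (from-yes (all? (λ c → ∀-Dir? (λ u → ¬? (run? P₃₁? u 3 c))) cellsP))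

no-Run₄ : ∀ p u → ¬ Run P₃₁ u 4 p
no-Run₄ = no-longer-Run no-Run₃-from-cells

guards₃₁? : ∀ p q → Dec (Guards P₃₁ p q)
guards₃₁? = guards? P₃₁? no-Run₄

attack₃₁? : ∀ p q → Dec (Attack P₃₁ p q)
attack₃₁? = attack? P₃₁? no-Run₄

independentCells : List (List Cube)
independentCells = independentSublists attack₃₁? cellsP

-- rooksA and rooksB, listed in the order of cellsP.
rooksA′ rooksB′ : List Cube
rooksA′ = pt (- + 2) (+ 0) ∷ pt (- + 1) (- + 1) ∷ pt (+ 0) (- + 2) ∷
          pt (+ 0) (+ 2) ∷ pt (+ 1) (+ 1) ∷ pt (+ 2) (+ 0) ∷ []
rooksB′ = pt (- + 2) (+ 0) ∷ pt (- + 1) (+ 1) ∷ pt (+ 0) (- + 2) ∷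
          pt (+ 0) (+ 2) ∷ pt (+ 1) (- + 1) ∷ pt (+ 2) (+ 0) ∷ []

independentCells-≤6 : All (λ T → length T ≤ 6) independentCells
independentCells-≤6 = from-yes (all? (λ T → length T ≤? 6) independentCells)

independentCells-6 : filter (λ T → length T ℕ.≟ 6) independentCells ≡ rooksA′ ∷ rooksB′ ∷ []
independentCells-6 = refl

nonAttacking⇒↭independentCell : ∀ {S} → NonAttacking P₃₁ S →
                                Σ (List Cube) λ T → T ∈ independentCells × S ↭ T
nonAttacking⇒↭independentCell {S} ((S! , S⊆P) , S-pairs) =
  _ , ∈-independentSublists attack₃₁? (filter-⊆ (_∈? S) cellsP)
        (AllPairs-resp-↭ (¬Attack-sym {P₃₁}) S↭T S-pairs) , S↭T
  where
  S↭T : S ↭ filter (_∈? S) cellsP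
  S↭T = ↭-filter-∈ _≟ᶜ_ S! cellsP-unique S⊆P

nonAttacking-length≤6 : ∀ {S} → NonAttacking P₃₁ S → length S ≤ 6
nonAttacking-length≤6 na =
  let (T , T∈ , S↭T) = nonAttacking⇒↭independentCell na
  in subst (_≤ 6) (sym (↭-length S↭T)) (All.lookup independentCells-≤6 T∈)

independentCells-length≡6 : ∀ {T} → T ∈ independentCells → length T ≡ 6 →
                            T ≡ rooksA′ ⊎ T ≡ rooksB′
independentCells-length≡6 {T} T∈ six =
  ∈-pair (subst (T ∈_) independentCells-6 (∈-filter⁺ (λ T → length T ℕ.≟ 6) T∈ six))
  where
  ∈-pair : ∀ {a b} → T ∈ a ∷ b ∷ [] → T ≡ a ⊎ T ≡ b
  ∈-pair (here T≡a)         = inj₁ T≡a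
  ∈-pair (there (here T≡b)) = inj₂ T≡b

open SubsetDec _≟ᶜ_ using (_⊆?_)

rooksA′≈rooksA : SameSet rooksA′ rooksA
rooksA′≈rooksA = ⊆∧⊇⇒SameSet (from-yes (rooksA′ ⊆? rooksA)) (from-yes (rooksA ⊆? rooksA′))

rooksB′≈rooksB : SameSet rooksB′ rooksB
rooksB′≈rooksB = ⊆∧⊇⇒SameSet (from-yes (rooksB′ ⊆? rooksB)) (from-yes (rooksB ⊆? rooksB′))

nonAttacking-length≡6 : ∀ {S} → NonAttacking P₃₁ S → length S ≡ 6 →
                        SameSet S rooksA ⊎ SameSet S rooksB
nonAttacking-length≡6 {S} na six = classify (nonAttacking⇒↭independentCell na)
  where
  classify : Σ (List Cube) (λ T → T ∈ independentCells × S ↭ T) →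
             SameSet S rooksA ⊎ SameSet S rooksB
  classify (T , T∈ , S↭T) =
    [ (λ { refl → inj₁ (SameSet-trans (↭⇒SameSet S↭T) rooksA′≈rooksA) })
    , (λ { refl → inj₂ (SameSet-trans (↭⇒SameSet S↭T) rooksB′≈rooksB) })
    ]′ (independentCells-length≡6 T∈ (trans (sym (↭-length S↭T)) six))

nonAttacking-rooksA : NonAttacking P₃₁ rooksA
nonAttacking-rooksA = from-yes (nonAttacking? P₃₁? no-Run₄ rooksA)

nonAttacking-rooksB : NonAttacking P₃₁ rooksB
nonAttacking-rooksB = from-yes (nonAttacking? P₃₁? no-Run₄ rooksB)

dominates-rooksA : Dominates P₃₁ rooksA
dominates-rooksA = guarded⇒Dominates cellsP rooksA
  (from-yes (all? (λ q → any? (λ p → guards₃₁? p q) rooksA) cellsP))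

dominates-rooksB : Dominates P₃₁ rooksB
dominates-rooksB = guarded⇒Dominates cellsP rooksB
  (from-yes (all? (λ q → any? (λ p → guards₃₁? p q) rooksB) cellsP))

nonAttacking-length≡6⇒Dominates : ∀ {S} → NonAttacking P₃₁ S → length S ≡ 6 → Dominates P₃₁ S
nonAttacking-length≡6⇒Dominates na six =
  [ (λ S≈A → Dominates-resp-SameSet S≈A dominates-rooksA)
  , (λ S≈B → Dominates-resp-SameSet S≈B dominates-rooksB)
  ]′ (nonAttacking-length≡6 na six)

lemma3p1 :
    -- the maximum number of pairwise non-attacking rooks on P is 6
    (Σ (List Cube) (λ S → NonAttacking P₃₁ S × length S ≡ 6)) ×
    (∀ S → NonAttacking P₃₁ S → length S ≤ 6) ×
    -- such a maximum set dominates P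
    (∀ S → NonAttacking P₃₁ S → length S ≡ 6 → Dominates P₃₁ S) ×
    -- exactly two such sets: rooksA and rooksB
    NonAttacking P₃₁ rooksA × NonAttacking P₃₁ rooksB ×
    (∀ S → NonAttacking P₃₁ S → length S ≡ 6 → SameSet S rooksA ⊎ SameSet S rooksB)
lemma3p1 =
  (rooksA , nonAttacking-rooksA , refl) ,
  (λ _ → nonAttacking-length≤6) ,
  (λ _ → nonAttacking-length≡6⇒Dominates) ,
  nonAttacking-rooksA , nonAttacking-rooksB ,
  (λ _ → nonAttacking-length≡6)
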